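{- For integers $n,k\ge 1$, \[f_{\mathrm{FR}}(n,k)=k\bigl(f_{\mathrm{FR}}(n-1,k)+f_{\mathrm{FR}}(n-1,k-1)\bigr),\] where $f_{\mathrm{FR}}(m,j)$ denotes the number of Fubini rankings with $m$ competitors having exactly $j$ lucky cars.
   Context: A Fubini ranking with $m$ competitors is a tuple $\alpha=(a_1,\ldots,a_m)\in\{1,\ldots,m\}^m$ such that $a_i=1+|\{j: a_j<a_i\}|$ for every $i$; for $m=0$ there is exactly one Fubini ranking (the empty one), with $0$ lucky cars. Lucky cars: cars $1,\ldots,m$ enter in order a one-way street with spots $1,\ldots,m$; car $i$ parks at spot $a_i$ if free, else at the first free spot after $a_i$; car $i$ is lucky if it parks at spot $a_i$. Thus $f_{\mathrm{FR}}(0,0)=1$ and $f_{\mathrm{FR}}(0,j)=0$ for $j\ne0$. -}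

module Defs where

open import Data.Nat using (ℕ; zero; suc; _+_; _≡ᵇ_; _<ᵇ_)
open import Data.Bool using (Bool; true; false; if_then_else_; _∧_; not)
open import Data.List using (List; []; _∷_; map; concatMap; filter; length; upTo)
open import Data.Bool.ListAction using (all; any)
open import Relation.Nullary.Decidable using (does)
open import Data.Bool.Properties using (_≟_)

range1 : ℕ → List ℕ
range1 m = map suc (upTo m)

tuples : ℕ → ℕ → List (List ℕ)
tuples m zero = [] ∷ []
tuples m (suc len) = concatMap (λ a → map (a ∷_) (tuples m len)) (range1 m)

countLess : ℕ → List ℕ → ℕ
countLess a [] = 0
countLess a (b ∷ bs) = if b <ᵇ a then suc (countLess a bs) else countLess a bs

isFubini : List ℕ → Bool
isFubini α = all (λ a → a ≡ᵇ suc (countLess a α)) α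

occupied : ℕ → List ℕ → Bool
occupied s occ = any (s ≡ᵇ_) occ

firstFree : List ℕ → List ℕ → List ℕ
firstFree [] occ = []
firstFree (s ∷ ss) occ = if occupied s occ then firstFree ss occ else s ∷ []

spotsFrom : ℕ → ℕ → List ℕ
spotsFrom m a = filter (λ s → ((a <ᵇ s) Data.Bool.∨ (a ≡ᵇ s)) ≟ true) (range1 m)

luckyGo : ℕ → List ℕ → List ℕ → ℕ
luckyGo m occ [] = 0
luckyGo m occ (a ∷ as) =
  if occupied a occ
  then luckyGo m (firstFree (spotsFrom m a) occ Data.List.++ occ) as
  else suc (luckyGo m (a ∷ occ) as)

lucky : ℕ → List ℕ → ℕ
lucky m α = luckyGo m [] α

fFR : ℕ → ℕ → ℕ
fFR m j = length (filter (λ α → (isFubini α ∧ (lucky m α ≡ᵇ j)) ≟ true) (tuples m m))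

{-# OPTIONS --safe #-}
module Submission where

-- In a Fubini ranking a value b occurring c times is shared by c tied competitors, so the next
-- larger value is at least b + c: the runs [b, b + c) of the distinct values are disjoint and lie
-- in [1, m]. The cars preferring b park in the run of b one after the other, hence the lucky cars
-- are the first occurrences of the values, and their number is the number k of distinct values.
-- Delete the first entry a of a Fubini ranking with n competitors and close the gap above a.
-- If a is repeated, this is a bijection onto the pairs (β, a) with β a ranking with n − 1
-- competitors and k values, and a one of them; if a occurs once, onto the pairs with β having
-- k − 1 values and a = 1 + #{entries of β below a}, which are the k − 1 values of β and n.
-- Either way there are k choices of a for each β.


open import Defs
open import Data.Bool using (Bool; true; false; _∧_; _∨_; not; if_then_else_)
import Data.Bool.Properties as Bool
open import Data.Empty using (⊥; ⊥-elim)
open import Data.List using (List; []; _∷_; map; concatMap; filter; length; _++_; upTo; applyUpTo)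
import Data.List.Properties as List
open import Data.List.Relation.Unary.All as All using (All; []; _∷_)
open import Data.List.Relation.Unary.All.Properties using (all⁺; all⁻; concat⁺; map⁺; applyUpTo⁺₁)
open import Data.Nat using (ℕ; zero; suc; _+_; _*_; _∸_; _≥_; _≤_; _<_; z≤n; s≤s; _≡ᵇ_; _<ᵇ_)
open import Data.Nat.Properties
open import Algebra.Properties.CommutativeSemigroup +-commutativeSemigroup using (interchange)
open import Data.Product using (_×_; _,_; proj₁; proj₂; ∃-syntax)
open import Data.Sum using (_⊎_; inj₁; inj₂; [_,_]′)
open import Function using (_∘_; id; _⇔_; mk⇔; Equivalence)
open import Function.Definitions using (Injective)
open import Relation.Binary using (DecidableEquality; tri<; tri≈; tri>)
open import Relation.Binary.PropositionalEquality using (_≡_; _≢_; refl; sym; trans; cong; cong₂; subst; module ≡-Reasoning)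
open import Relation.Nullary using (¬_; Reflects; ofʸ; ofⁿ; does; yes; no)
open import Relation.Nullary.Decidable using (dec-true; dec-false; proof)
open import Relation.Unary using (_⊆_)

≡ᵇ-reflects-≡ : ∀ m n → Reflects (m ≡ n) (m ≡ᵇ n)
≡ᵇ-reflects-≡ m n = proof (m ≟ n)

<ᵇ∨≡ᵇ-reflects-≤ : ∀ m n → Reflects (m ≤ n) ((m <ᵇ n) ∨ (m ≡ᵇ n))
<ᵇ∨≡ᵇ-reflects-≤ m n with m <ᵇ n | <ᵇ-reflects-< m n | m ≡ᵇ n | ≡ᵇ-reflects-≡ m n
... | true  | ofʸ m<n | _     | _        = ofʸ (<⇒≤ m<n)
... | false | _       | true  | ofʸ refl = ofʸ ≤-refl
... | false | ofⁿ m≮n | false | ofⁿ m≢n = ofⁿ (λ m≤n → [ m≮n , m≢n ]′ (m≤n⇒m<n∨m≡n m≤n))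

∧≡true⁻ : ∀ b c → b ∧ c ≡ true → b ≡ true × c ≡ true
∧≡true⁻ true true refl = refl , refl

∧≡true⁺ : ∀ {b c} → b ≡ true → c ≡ true → b ∧ c ≡ true
∧≡true⁺ refl refl = refl

private
  variable
    A B : Set
    x y : ℕ

⟦_⟧ : Bool → ℕ
⟦ true ⟧ = 1
⟦ false ⟧ = 0

⟦∧⟧ : ∀ a b → ⟦ a ∧ b ⟧ ≡ ⟦ a ⟧ * ⟦ b ⟧
⟦∧⟧ true b = sym (+-identityʳ ⟦ b ⟧)
⟦∧⟧ false b = refl

⟦⟧-split : ∀ a b → ⟦ a ⟧ ≡ ⟦ a ∧ b ⟧ + ⟦ a ∧ not b ⟧
⟦⟧-split true true = refl
⟦⟧-split true false = refl
⟦⟧-split false b = refl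

∑ : List A → (A → ℕ) → ℕ
∑ [] f = 0
∑ (x ∷ xs) f = f x + ∑ xs f

syntax ∑ xs (λ x → e) = ∑[ x ∈ xs ] e

∑-cong : ∀ {f g : A → ℕ} xs → (∀ x → f x ≡ g x) → ∑ xs f ≡ ∑ xs g
∑-cong [] f≗g = refl
∑-cong (x ∷ xs) f≗g = cong₂ _+_ (f≗g x) (∑-cong xs f≗g)

∑-cong-All : ∀ {f g : A → ℕ} {xs} → All (λ x → f x ≡ g x) xs → ∑ xs f ≡ ∑ xs g
∑-cong-All [] = refl
∑-cong-All (fx≡gx ∷ eqs) = cong₂ _+_ fx≡gx (∑-cong-All eqs)

∑-zero : ∀ (xs : List A) → ∑[ x ∈ xs ] 0 ≡ 0
∑-zero [] = refl
∑-zero (x ∷ xs) = ∑-zero xs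

∑-+ : ∀ xs (f g : A → ℕ) → ∑[ x ∈ xs ] (f x + g x) ≡ ∑ xs f + ∑ xs g
∑-+ [] f g = refl
∑-+ (x ∷ xs) f g = begin
  f x + g x + ∑[ x ∈ xs ] (f x + g x) ≡⟨ cong (f x + g x +_) (∑-+ xs f g) ⟩
  f x + g x + (∑ xs f + ∑ xs g)       ≡⟨ interchange (f x) (g x) (∑ xs f) (∑ xs g) ⟩
  f x + ∑ xs f + (g x + ∑ xs g)       ∎
  where open ≡-Reasoning

∑-*ˡ : ∀ xs c (f : A → ℕ) → ∑[ x ∈ xs ] (c * f x) ≡ c * ∑ xs f
∑-*ˡ [] c f = sym (*-zeroʳ c)
∑-*ˡ (x ∷ xs) c f = trans (cong (c * f x +_) (∑-*ˡ xs c f)) (sym (*-distribˡ-+ c (f x) (∑ xs f)))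

∑-++ : ∀ xs ys (f : A → ℕ) → ∑ (xs ++ ys) f ≡ ∑ xs f + ∑ ys f
∑-++ [] ys f = refl
∑-++ (x ∷ xs) ys f = trans (cong (f x +_) (∑-++ xs ys f)) (sym (+-assoc (f x) (∑ xs f) (∑ ys f)))

∑-concatMap : ∀ xs (g : A → List B) (f : B → ℕ) → ∑ (concatMap g xs) f ≡ ∑[ x ∈ xs ] ∑ (g x) f
∑-concatMap [] g f = refl
∑-concatMap (x ∷ xs) g f = trans (∑-++ (g x) (concatMap g xs) f) (cong (∑ (g x) f +_) (∑-concatMap xs g f))

∑-map : ∀ xs (g : A → B) (f : B → ℕ) → ∑ (map g xs) f ≡ ∑[ x ∈ xs ] f (g x)
∑-map [] g f = refl
∑-map (x ∷ xs) g f = cong (f (g x) +_) (∑-map xs g f)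

∑-comm : ∀ xs (ys : List B) (h : A → B → ℕ) → ∑[ x ∈ xs ] ∑[ y ∈ ys ] h x y ≡ ∑[ y ∈ ys ] ∑[ x ∈ xs ] h x y
∑-comm [] ys h = sym (∑-zero ys)
∑-comm (x ∷ xs) ys h = trans (cong (∑ ys (h x) +_) (∑-comm xs ys h)) (sym (∑-+ ys (h x) (λ y → ∑[ x ∈ xs ] h x y)))

length-filter : ∀ (p : A → Bool) xs → length (filter (λ x → p x Bool.≟ true) xs) ≡ ∑[ x ∈ xs ] ⟦ p x ⟧
length-filter p [] = refl
length-filter p (x ∷ xs) with p x
... | true = cong suc (length-filter p xs)
... | false = length-filter p xs

∑-⟦⟧-split : ∀ xs (p q : A → Bool) →
  ∑[ x ∈ xs ] ⟦ p x ⟧ ≡ ∑[ x ∈ xs ] ⟦ p x ∧ q x ⟧ + ∑[ x ∈ xs ] ⟦ p x ∧ not (q x) ⟧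
∑-⟦⟧-split xs p q = trans (∑-cong xs (λ x → ⟦⟧-split (p x) (q x))) (∑-+ xs _ (λ x → ⟦ p x ∧ not (q x) ⟧))

∑-⟦∧⟧ : ∀ (xs : List A) b (p : A → Bool) → ∑[ x ∈ xs ] ⟦ b ∧ p x ⟧ ≡ ⟦ b ⟧ * ∑[ x ∈ xs ] ⟦ p x ⟧
∑-⟦∧⟧ xs b p = trans (∑-cong xs (λ x → ⟦∧⟧ b (p x))) (∑-*ˡ xs ⟦ b ⟧ _)

-- Counting by a bijection

multiplicity : DecidableEquality A → A → List A → ℕ
multiplicity _≟_ x xs = ∑[ y ∈ xs ] ⟦ does (x ≟ y) ⟧

record Enumerates (_≟_ : DecidableEquality A) (V : A → Set) (xs : List A) : Set where
  field
    members : All V xs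
    once    : ∀ {x} → V x → multiplicity _≟_ x xs ≡ 1

open Enumerates

⟦⟧*multiplicity : ∀ {_≟_ : DecidableEquality A} {V xs} → Enumerates _≟_ V xs →
  ∀ b x → (b ≡ true → V x) → ⟦ b ⟧ * multiplicity _≟_ x xs ≡ ⟦ b ⟧
⟦⟧*multiplicity enum true x v = trans (+-identityʳ _) (once enum (v refl))
⟦⟧*multiplicity enum false x v = refl

module _ {_≟ᴬ_ : DecidableEquality A} {_≟ᴮ_ : DecidableEquality B}
         {V : A → Set} {W : B → Set} {xs : List A} {ys : List B}
         (enumV : Enumerates _≟ᴬ_ V xs) (enumW : Enumerates _≟ᴮ_ W ys)
         {p : A → Bool} {q : B → Bool} (f : A → B) (g : B → A)
         (f-maps : ∀ {x} → V x → p x ≡ true → W (f x) × q (f x) ≡ true × g (f x) ≡ x)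
         (g-maps : ∀ {y} → W y → q y ≡ true → V (g y) × p (g y) ≡ true × f (g y) ≡ y) where

  private
    backward-zero : ∀ {x y} → W y → (p x ≡ true → f x ≡ y → ⊥) → ⟦ q y ⟧ * ⟦ does (g y ≟ᴬ x) ⟧ ≡ 0
    backward-zero {x} {y} wy ¬forward with q y in qy | g y ≟ᴬ x
    ... | true  | yes refl = let (_ , pgy , fgy) = g-maps wy qy in ⊥-elim (¬forward pgy fgy)
    ... | true  | no _     = refl
    ... | false | _        = refl

    pointwise : ∀ {x y} → V x → W y → ⟦ p x ⟧ * ⟦ does (f x ≟ᴮ y) ⟧ ≡ ⟦ q y ⟧ * ⟦ does (g y ≟ᴬ x) ⟧
    pointwise {x} {y} vx wy with p x in px | f x ≟ᴮ y
    ... | true  | yes refl = let (_ , qfx , gfx) = f-maps vx px in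
                             sym (cong₂ (λ b c → ⟦ b ⟧ * ⟦ c ⟧) qfx (dec-true (g (f x) ≟ᴬ x) gfx))
    ... | true  | no fx≢y  = sym (backward-zero wy (λ _ → fx≢y))
    ... | false | _        = sym (backward-zero wy (λ px≡true _ → Bool.not-¬ px px≡true))

  count-bijection : ∑[ x ∈ xs ] ⟦ p x ⟧ ≡ ∑[ y ∈ ys ] ⟦ q y ⟧
  count-bijection = begin
    ∑[ x ∈ xs ] ⟦ p x ⟧
      ≡⟨ ∑-cong-All (All.map (λ vx → ⟦⟧*multiplicity enumW (p _) _ (λ px → proj₁ (f-maps vx px))) (members enumV)) ⟨
    ∑[ x ∈ xs ] (⟦ p x ⟧ * multiplicity _≟ᴮ_ (f x) ys)
      ≡⟨ ∑-cong xs (λ x → ∑-*ˡ ys ⟦ p x ⟧ _) ⟨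
    ∑[ x ∈ xs ] ∑[ y ∈ ys ] (⟦ p x ⟧ * ⟦ does (f x ≟ᴮ y) ⟧)
      ≡⟨ ∑-comm xs ys _ ⟩
    ∑[ y ∈ ys ] ∑[ x ∈ xs ] (⟦ p x ⟧ * ⟦ does (f x ≟ᴮ y) ⟧)
      ≡⟨ ∑-cong-All (All.map (λ wy → ∑-cong-All (All.map (λ vx → pointwise vx wy) (members enumV))) (members enumW)) ⟩
    ∑[ y ∈ ys ] ∑[ x ∈ xs ] (⟦ q y ⟧ * ⟦ does (g y ≟ᴬ x) ⟧)
      ≡⟨ ∑-cong ys (λ y → ∑-*ˡ xs ⟦ q y ⟧ _) ⟩
    ∑[ y ∈ ys ] (⟦ q y ⟧ * multiplicity _≟ᴬ_ (g y) xs)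
      ≡⟨ ∑-cong-All (All.map (λ wy → ⟦⟧*multiplicity enumV (q _) _ (λ qy → proj₁ (g-maps wy qy))) (members enumW)) ⟩
    ∑[ y ∈ ys ] ⟦ q y ⟧ ∎
    where open ≡-Reasoning

copies : ℕ → List ℕ → ℕ
copies x xs = ∑[ y ∈ xs ] ⟦ x ≡ᵇ y ⟧

occupied-head : ∀ x xs → occupied x (x ∷ xs) ≡ true
occupied-head x xs rewrite dec-true (x ≟ x) refl = refl

occupied-tail : ∀ x y xs → occupied x xs ≡ true → occupied x (y ∷ xs) ≡ true
occupied-tail x y xs x∈xs rewrite x∈xs = Bool.∨-zeroʳ (x ≡ᵇ y)

occupied-self : ∀ xs → All (λ x → occupied x xs ≡ true) xs
occupied-self [] = []
occupied-self (x ∷ xs) = occupied-head x xs ∷ All.map (λ {y} → occupied-tail y x xs) (occupied-self xs)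

lookup-occupied : ∀ {P : ℕ → Set} x xs → All P xs → occupied x xs ≡ true → P x
lookup-occupied x (y ∷ xs) (py ∷ pxs) x∈ with x ≡ᵇ y | ≡ᵇ-reflects-≡ x y
... | true  | ofʸ refl = py
... | false | ofⁿ _    = lookup-occupied x xs pxs x∈

occupied⇒copies>0 : ∀ x xs → occupied x xs ≡ true → 0 < copies x xs
occupied⇒copies>0 x (y ∷ xs) x∈ with x ≡ᵇ y
... | true  = s≤s z≤n
... | false = occupied⇒copies>0 x xs x∈

copies>0⇒occupied : ∀ x xs → 0 < copies x xs → occupied x xs ≡ true
copies>0⇒occupied x (y ∷ xs) 0<c with x ≡ᵇ y
... | true  = refl
... | false = copies>0⇒occupied x xs 0<c

copies-head : ∀ x xs → copies x (x ∷ xs) ≡ suc (copies x xs)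
copies-head x xs rewrite dec-true (x ≟ x) refl = refl

copies-absent : ∀ x xs → occupied x xs ≡ false → copies x xs ≡ 0
copies-absent x [] x∉ = refl
copies-absent x (y ∷ xs) x∉ with x ≡ᵇ y
... | false = copies-absent x xs x∉

copies-∷-≤ : ∀ x y xs → copies x xs ≤ copies x (y ∷ xs)
copies-∷-≤ x y xs = m≤n+m (copies x xs) ⟦ x ≡ᵇ y ⟧

occupied-map⁺ : ∀ (h : ℕ → ℕ) x s → occupied x s ≡ true → occupied (h x) (map h s) ≡ true
occupied-map⁺ h x (y ∷ s) x∈y∷s with x ≡ᵇ y | ≡ᵇ-reflects-≡ x y
... | true  | ofʸ refl rewrite dec-true (h x ≟ h x) refl = refl
... | false | ofⁿ _    = occupied-tail (h x) (h y) (map h s) (occupied-map⁺ h x s x∈y∷s)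

occupied-map : ∀ {h : ℕ → ℕ} → Injective _≡_ _≡_ h → ∀ x s → occupied (h x) (map h s) ≡ occupied x s
occupied-map h-inj x [] = refl
occupied-map {h} h-inj x (y ∷ s) with x ≡ᵇ y | ≡ᵇ-reflects-≡ x y
... | true  | ofʸ refl rewrite dec-true (h x ≟ h x) refl = refl
... | false | ofⁿ x≢y  rewrite dec-false (h x ≟ h y) (x≢y ∘ h-inj) = occupied-map h-inj x s

absent⇒All≢ : ∀ c xs → occupied c xs ≡ false → All (_≢ c) xs
absent⇒All≢ c [] c∉ = []
absent⇒All≢ c (x ∷ xs) c∉ with c ≡ᵇ x | ≡ᵇ-reflects-≡ c x
... | false | ofⁿ c≢x = (c≢x ∘ sym) ∷ absent⇒All≢ c xs c∉

All≢⇒absent : ∀ c xs → All (_≢ c) xs → occupied c xs ≡ false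
All≢⇒absent c [] [] = refl
All≢⇒absent c (x ∷ xs) (x≢c ∷ xs≢c) rewrite dec-false (c ≟ x) (x≢c ∘ sym) = All≢⇒absent c xs xs≢c

countLess-∷-≮ : ∀ {x y xs} → ¬ y < x → countLess x (y ∷ xs) ≡ countLess x xs
countLess-∷-≮ {x} {y} y≮x rewrite dec-false (y <? x) y≮x = refl

countLess-suc : ∀ x xs → countLess (suc x) xs ≡ countLess x xs + copies x xs
countLess-suc x [] = refl
countLess-suc x (y ∷ xs) with <-cmp y x
... | tri< y<x _ _
  rewrite dec-true (y <? suc x) (m<n⇒m<1+n y<x) | dec-true (y <? x) y<x | dec-false (x ≟ y) (<⇒≢ y<x ∘ sym)
  = cong suc (countLess-suc x xs)
... | tri≈ _ refl _
  rewrite dec-true (y <? suc y) ≤-refl | dec-false (y <? y) (n≮n y) | dec-true (y ≟ y) refl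
  = trans (cong suc (countLess-suc y xs)) (sym (+-suc _ _))
... | tri> _ _ x<y
  rewrite dec-false (y <? suc x) (<⇒≱ x<y ∘ ≤-pred) | dec-false (y <? x) (<⇒≯ x<y) | dec-false (x ≟ y) (<⇒≢ x<y)
  = countLess-suc x xs

countLess-mono : ∀ xs → x ≤ y → countLess x xs ≤ countLess y xs
countLess-mono [] x≤y = z≤n
countLess-mono {x} {y} (z ∷ xs) x≤y with z <ᵇ x | <ᵇ-reflects-< z x | z <ᵇ y | <ᵇ-reflects-< z y
... | true  | _        | true  | _        = s≤s (countLess-mono xs x≤y)
... | true  | ofʸ z<x  | false | ofⁿ z≮y = ⊥-elim (z≮y (<-≤-trans z<x x≤y))
... | false | _        | true  | _        = m≤n⇒m≤1+n (countLess-mono xs x≤y)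
... | false | _        | false | _        = countLess-mono xs x≤y

countLess+copies≤length : ∀ x xs → countLess x xs + copies x xs ≤ length xs
countLess+copies≤length x [] = z≤n
countLess+copies≤length x (y ∷ xs) with y <ᵇ x | <ᵇ-reflects-< y x | x ≡ᵇ y | ≡ᵇ-reflects-≡ x y
... | true  | ofʸ y<x | true  | ofʸ refl = ⊥-elim (n≮n x y<x)
... | true  | _       | false | _        = s≤s (countLess+copies≤length x xs)
... | false | _       | true  | _        = subst (_≤ suc (length xs)) (sym (+-suc _ _)) (s≤s (countLess+copies≤length x xs))
... | false | _       | false | _        = m≤n⇒m≤1+n (countLess+copies≤length x xs)

countLess-above : ∀ xs → All (_< y) xs → countLess y xs ≡ length xs
countLess-above [] [] = refl
countLess-above {y} (x ∷ xs) (x<y ∷ xs<y) rewrite dec-true (x <? y) x<y = cong suc (countLess-above xs xs<y)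

countLess-map : ∀ (h : ℕ → ℕ) x z xs → (∀ y → (h y <ᵇ x) ≡ (y <ᵇ z)) → countLess x (map h xs) ≡ countLess z xs
countLess-map h x z [] h≈ = refl
countLess-map h x z (y ∷ xs) h≈ rewrite h≈ y with y <ᵇ z
... | true  = cong suc (countLess-map h x z xs h≈)
... | false = countLess-map h x z xs h≈

InRange : ℕ → ℕ → Set
InRange m x = 1 ≤ x × x ≤ m

interval : ℕ → ℕ → List ℕ
interval x zero = []
interval x (suc c) = x ∷ interval (suc x) c

applyUpTo≡interval : ∀ (f : ℕ → ℕ) x c → (∀ i → f i ≡ x + i) → applyUpTo f c ≡ interval x c
applyUpTo≡interval f x zero f≗x+ = refl
applyUpTo≡interval f x (suc c) f≗x+ =
  cong₂ _∷_ (trans (f≗x+ 0) (+-identityʳ x))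
            (applyUpTo≡interval (f ∘ suc) (suc x) c (λ i → trans (f≗x+ (suc i)) (+-suc x i)))

range1≡interval : ∀ m → range1 m ≡ interval 1 m
range1≡interval m = trans (List.map-applyUpTo id suc m) (applyUpTo≡interval suc 1 m (λ _ → refl))

range1-∷ʳ : ∀ m → range1 (suc m) ≡ range1 m ++ suc m ∷ []
range1-∷ʳ m = trans (cong (map suc) (sym (List.upTo-∷ʳ m))) (List.map-++ suc (upTo m) (m ∷ []))

range1-inRange : ∀ m → All (InRange m) (range1 m)
range1-inRange m = map⁺ (applyUpTo⁺₁ id m (λ i<m → s≤s z≤n , i<m))

copies-interval-below : ∀ {y} x c → y < x → copies y (interval x c) ≡ 0
copies-interval-below x zero y<x = refl
copies-interval-below {y} x (suc c) y<x
  rewrite dec-false (y ≟ x) (<⇒≢ y<x) = copies-interval-below (suc x) c (m<n⇒m<1+n y<x)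

copies-interval : ∀ {y} x c → x ≤ y → y < x + c → copies y (interval x c) ≡ 1
copies-interval {y} x zero x≤y y<x+0 = ⊥-elim (<⇒≱ (subst (y <_) (+-identityʳ x) y<x+0) x≤y)
copies-interval {y} x (suc c) x≤y y<x+1+c with y ≡ᵇ x | ≡ᵇ-reflects-≡ y x
... | true  | ofʸ refl = cong suc (copies-interval-below {x} (suc x) c ≤-refl)
... | false | ofⁿ y≢x  = copies-interval (suc x) c (≤∧≢⇒< x≤y (y≢x ∘ sym)) (subst (y <_) (+-suc x c) y<x+1+c)

copies-range1 : ∀ {m y} → InRange m y → copies y (range1 m) ≡ 1
copies-range1 {m} {y} (1≤y , y≤m) = trans (cong (copies y) (range1≡interval m)) (copies-interval 1 m 1≤y (s≤s y≤m))

InRange-suc : ∀ {n} → All (InRange n) ⊆ All (InRange (suc n))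
InRange-suc = All.map (λ (1≤x , x≤n) → 1≤x , m≤n⇒m≤1+n x≤n)

Tuple : ℕ → ℕ → List ℕ → Set
Tuple m len β = length β ≡ len × All (InRange m) β

∑-tuples-∷ : ∀ m len (f : List ℕ → ℕ) →
  ∑ (tuples m (suc len)) f ≡ ∑[ a ∈ range1 m ] ∑[ β ∈ tuples m len ] f (a ∷ β)
∑-tuples-∷ m len f = trans (∑-concatMap (range1 m) _ f) (∑-cong (range1 m) (λ a → ∑-map (tuples m len) (a ∷_) f))

tuples-valid : ∀ m len → All (Tuple m len) (tuples m len)
tuples-valid m zero = (refl , []) ∷ []
tuples-valid m (suc len) = concat⁺ (map⁺ (All.map prepend (range1-inRange m)))
  where
  prepend : ∀ {a} → InRange m a → All (Tuple m (suc len)) (map (a ∷_) (tuples m len))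
  prepend a∈ = map⁺ (All.map (λ (l , β∈) → cong suc l , a∈ ∷ β∈) (tuples-valid m len))

tuples-once : ∀ m len {β} → Tuple m len β → multiplicity (List.≡-dec _≟_) β (tuples m len) ≡ 1
tuples-once m zero {[]} _ = refl
tuples-once m (suc len) {c ∷ β} (1+len≡len , c∈ ∷ β∈) = begin
  multiplicity (List.≡-dec _≟_) (c ∷ β) (tuples m (suc len))
    ≡⟨ ∑-tuples-∷ m len _ ⟩
  ∑[ a ∈ range1 m ] ∑[ γ ∈ tuples m len ] ⟦ (c ≡ᵇ a) ∧ does (List.≡-dec _≟_ β γ) ⟧
    ≡⟨ ∑-cong (range1 m) (λ a → ∑-⟦∧⟧ (tuples m len) (c ≡ᵇ a) _) ⟩
  ∑[ a ∈ range1 m ] (⟦ c ≡ᵇ a ⟧ * multiplicity (List.≡-dec _≟_) β (tuples m len))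
    ≡⟨ ∑-cong (range1 m) (λ a → trans (cong (⟦ c ≡ᵇ a ⟧ *_) (tuples-once m len (suc-injective 1+len≡len , β∈)))
                                       (*-identityʳ _)) ⟩
  copies c (range1 m)
    ≡⟨ copies-range1 c∈ ⟩
  1 ∎
  where open ≡-Reasoning

tuples-enumerates : ∀ m len → Enumerates (List.≡-dec _≟_) (Tuple m len) (tuples m len)
tuples-enumerates m len = record { members = tuples-valid m len ; once = tuples-once m len }

-- Distinct values

countFresh : List ℕ → List ℕ → ℕ
countFresh seen [] = 0
countFresh seen (b ∷ β) = ⟦ not (occupied b seen) ⟧ + countFresh (b ∷ seen) β

SameElements : List ℕ → List ℕ → Set
SameElements s t = ∀ x → occupied x s ≡ occupied x t

SameElements-∷ : ∀ b s t → SameElements s t → SameElements (b ∷ s) (b ∷ t)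
SameElements-∷ b s t s≈t x = cong ((x ≡ᵇ b) ∨_) (s≈t x)

SameElements-swap : ∀ a b s → SameElements (a ∷ b ∷ s) (b ∷ a ∷ s)
SameElements-swap a b s x = begin
  (x ≡ᵇ a) ∨ ((x ≡ᵇ b) ∨ occupied x s)   ≡⟨ Bool.∨-assoc (x ≡ᵇ a) (x ≡ᵇ b) _ ⟨
  ((x ≡ᵇ a) ∨ (x ≡ᵇ b)) ∨ occupied x s   ≡⟨ cong (_∨ occupied x s) (Bool.∨-comm (x ≡ᵇ a) (x ≡ᵇ b)) ⟩
  ((x ≡ᵇ b) ∨ (x ≡ᵇ a)) ∨ occupied x s   ≡⟨ Bool.∨-assoc (x ≡ᵇ b) (x ≡ᵇ a) _ ⟩
  (x ≡ᵇ b) ∨ ((x ≡ᵇ a) ∨ occupied x s)   ∎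
  where open ≡-Reasoning

SameElements-dup : ∀ a s → SameElements (a ∷ a ∷ s) (a ∷ s)
SameElements-dup a s x = trans (sym (Bool.∨-assoc (x ≡ᵇ a) (x ≡ᵇ a) _)) (cong (_∨ occupied x s) (Bool.∨-idem (x ≡ᵇ a)))

countFresh-cong : ∀ s t → SameElements s t → ∀ β → countFresh s β ≡ countFresh t β
countFresh-cong s t s≈t [] = refl
countFresh-cong s t s≈t (b ∷ β) =
  cong₂ (λ u n → ⟦ not u ⟧ + n) (s≈t b) (countFresh-cong (b ∷ s) (b ∷ t) (SameElements-∷ b s t s≈t) β)

countFresh-absent : ∀ a s β → occupied a β ≡ false → countFresh (a ∷ s) β ≡ countFresh s β
countFresh-absent a s [] a∉β = refl
countFresh-absent a s (b ∷ β) a∉b∷β with a ≡ᵇ b | ≡ᵇ-reflects-≡ a b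
... | false | ofⁿ a≢b rewrite dec-false (b ≟ a) (a≢b ∘ sym) =
  cong (⟦ not (occupied b s) ⟧ +_)
       (trans (countFresh-cong _ _ (SameElements-swap b a s) β) (countFresh-absent a (b ∷ s) β a∉b∷β))

countFresh-present : ∀ a s β → occupied a s ≡ false → occupied a β ≡ true → suc (countFresh (a ∷ s) β) ≡ countFresh s β
countFresh-present a s (b ∷ β) a∉s a∈b∷β with a ≡ᵇ b | ≡ᵇ-reflects-≡ a b
... | true  | ofʸ refl rewrite a∉s | dec-true (a ≟ a) refl = cong suc (countFresh-cong _ _ (SameElements-dup a s) β)
... | false | ofⁿ a≢b rewrite dec-false (b ≟ a) (a≢b ∘ sym) = begin
  suc (new + countFresh (b ∷ a ∷ s) β)   ≡⟨ cong (λ n → suc (new + n)) (countFresh-cong _ _ (SameElements-swap b a s) β) ⟩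
  suc (new + countFresh (a ∷ b ∷ s) β)   ≡⟨ +-suc new _ ⟨
  new + suc (countFresh (a ∷ b ∷ s) β)   ≡⟨ cong (new +_) (countFresh-present a (b ∷ s) β a∉b∷s a∈b∷β) ⟩
  new + countFresh (b ∷ s) β             ∎
  where
  open ≡-Reasoning
  new = ⟦ not (occupied b s) ⟧
  a∉b∷s : occupied a (b ∷ s) ≡ false
  a∉b∷s = trans (cong (_∨ occupied a s) (dec-false (a ≟ b) a≢b)) a∉s

countFresh-map : ∀ {h : ℕ → ℕ} → Injective _≡_ _≡_ h → ∀ s β → countFresh (map h s) (map h β) ≡ countFresh s β
countFresh-map h-inj s [] = refl
countFresh-map {h} h-inj s (b ∷ β) = cong₂ (λ u n → ⟦ not u ⟧ + n) (occupied-map h-inj b s) (countFresh-map h-inj (b ∷ s) β)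

private
  ⟦∨∧not⟧ : ∀ e g t → ⟦ (e ∨ g) ∧ not t ⟧ ≡ ⟦ g ∧ not (e ∨ t) ⟧ + ⟦ e ∧ not t ⟧
  ⟦∨∧not⟧ true true t = refl
  ⟦∨∧not⟧ true false t = refl
  ⟦∨∧not⟧ false g t = sym (+-identityʳ _)

  ⟦≡ᵇ∧⟧ : ∀ (u : ℕ → Bool) a b → ⟦ (a ≡ᵇ b) ∧ u a ⟧ ≡ ⟦ u b ⟧ * ⟦ b ≡ᵇ a ⟧
  ⟦≡ᵇ∧⟧ u a b with a ≡ᵇ b | ≡ᵇ-reflects-≡ a b
  ... | true  | ofʸ refl rewrite dec-true (a ≟ a) refl = sym (*-identityʳ _)
  ... | false | ofⁿ a≢b  rewrite dec-false (b ≟ a) (a≢b ∘ sym) = sym (*-zeroʳ ⟦ u b ⟧)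

countFresh≡∑ : ∀ N s β → All (InRange N) β → ∑[ a ∈ range1 N ] ⟦ occupied a β ∧ not (occupied a s) ⟧ ≡ countFresh s β
countFresh≡∑ N s [] [] = ∑-zero (range1 N)
countFresh≡∑ N s (b ∷ β) (b∈ ∷ β∈) = begin
  ∑[ a ∈ range1 N ] ⟦ ((a ≡ᵇ b) ∨ occupied a β) ∧ not (occupied a s) ⟧
    ≡⟨ ∑-cong (range1 N) (λ a → ⟦∨∧not⟧ (a ≡ᵇ b) (occupied a β) (occupied a s)) ⟩
  ∑[ a ∈ range1 N ] (⟦ occupied a β ∧ not (occupied a (b ∷ s)) ⟧ + ⟦ (a ≡ᵇ b) ∧ not (occupied a s) ⟧)
    ≡⟨ ∑-+ (range1 N) _ _ ⟩
  fresh-later + ∑[ a ∈ range1 N ] ⟦ (a ≡ᵇ b) ∧ not (occupied a s) ⟧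
    ≡⟨ cong₂ _+_ (countFresh≡∑ N (b ∷ s) β β∈) (∑-cong (range1 N) (λ a → ⟦≡ᵇ∧⟧ (λ a → not (occupied a s)) a b)) ⟩
  countFresh (b ∷ s) β + ∑[ a ∈ range1 N ] (new * ⟦ b ≡ᵇ a ⟧)
    ≡⟨ cong (countFresh (b ∷ s) β +_) (∑-*ˡ (range1 N) new (λ a → ⟦ b ≡ᵇ a ⟧)) ⟩
  countFresh (b ∷ s) β + new * copies b (range1 N)
    ≡⟨ cong (λ c → countFresh (b ∷ s) β + new * c) (copies-range1 b∈) ⟩
  countFresh (b ∷ s) β + new * 1
    ≡⟨ trans (cong (countFresh (b ∷ s) β +_) (*-identityʳ new)) (+-comm (countFresh (b ∷ s) β) new) ⟩
  new + countFresh (b ∷ s) β ∎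
  where
  open ≡-Reasoning
  new = ⟦ not (occupied b s) ⟧
  fresh-later = ∑[ a ∈ range1 N ] ⟦ occupied a β ∧ not (occupied a (b ∷ s)) ⟧

distinct≡∑ : ∀ N β → All (InRange N) β → ∑[ a ∈ range1 N ] ⟦ occupied a β ⟧ ≡ countFresh [] β
distinct≡∑ N β β∈ =
  trans (∑-cong (range1 N) (λ a → cong ⟦_⟧ (sym (Bool.∧-identityʳ (occupied a β))))) (countFresh≡∑ N [] β β∈)

-- Parking

firstFree-interval : ∀ {b t occ} → b ≤ t → (∀ s → b ≤ s → s < t → occupied s occ ≡ true) → occupied t occ ≡ false →
  ∀ x c → x ≤ t → t < x + c → firstFree (filter (λ s → ((b <ᵇ s) ∨ (b ≡ᵇ s)) Bool.≟ true) (interval x c)) occ ≡ t ∷ []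
firstFree-interval {t = t} b≤t filled t-free x zero x≤t t<x+0 = ⊥-elim (<⇒≱ (subst (t <_) (+-identityʳ x) t<x+0) x≤t)
firstFree-interval {b} {t} {occ} b≤t filled t-free x (suc c) x≤t t<x+1+c
  with (b <ᵇ x) ∨ (b ≡ᵇ x) | <ᵇ∨≡ᵇ-reflects-≤ b x | m≤n⇒m<n∨m≡n x≤t
... | false | ofⁿ b≰x | inj₂ refl = ⊥-elim (b≰x b≤t)
... | false | ofⁿ b≰x | inj₁ x<t  = firstFree-interval b≤t filled t-free (suc x) c x<t (subst (t <_) (+-suc x c) t<x+1+c)
... | true  | ofʸ b≤x | inj₂ refl rewrite t-free = refl
... | true  | ofʸ b≤x | inj₁ x<t  rewrite filled x b≤x x<t =
  firstFree-interval b≤t filled t-free (suc x) c x<t (subst (t <_) (+-suc x c) t<x+1+c)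

firstFree-spotsFrom : ∀ {m b t occ} → 1 ≤ t → t ≤ m → b ≤ t → (∀ s → b ≤ s → s < t → occupied s occ ≡ true) →
  occupied t occ ≡ false → firstFree (spotsFrom m b) occ ≡ t ∷ []
firstFree-spotsFrom {m} {b} {t} {occ} 1≤t t≤m b≤t filled t-free =
  trans (cong (λ spots → firstFree (filter (λ s → ((b <ᵇ s) ∨ (b ≡ᵇ s)) Bool.≟ true) spots) occ) (range1≡interval m))
        (firstFree-interval b≤t filled t-free 1 m 1≤t (s≤s t≤m))

open Equivalence using (to; from)

Filled : List ℕ → ℕ → Set
Filled p s = ∃[ v ] v ≤ s × s < v + copies v p

Filled-∷⁺ : ∀ b p s → s ≡ b + copies b p ⊎ Filled p s → Filled (b ∷ p) s
Filled-∷⁺ b p s (inj₁ refl) = b , m≤m+n b _ , subst (λ c → b + copies b p < b + c) (sym (copies-head b p)) (+-monoʳ-< b ≤-refl)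
Filled-∷⁺ b p s (inj₂ (v , v≤s , s<v+c)) = v , v≤s , <-≤-trans s<v+c (+-monoʳ-≤ v (copies-∷-≤ v b p))

Filled-∷⁻ : ∀ b p s → Filled (b ∷ p) s → s ≡ b + copies b p ⊎ Filled p s
Filled-∷⁻ b p s (v , v≤s , s<v+c) with v ≡ᵇ b | ≡ᵇ-reflects-≡ v b
... | false | ofⁿ _    = inj₂ (v , v≤s , s<v+c)
... | true  | ofʸ refl with m≤n⇒m<n∨m≡n (≤-pred (subst (s <_) (+-suc v (copies v p)) s<v+c))
...   | inj₁ s<v+c′ = inj₂ (v , v≤s , s<v+c′)
...   | inj₂ s≡v+c′ = inj₁ s≡v+c′

Filled-[] : ∀ s → ¬ Filled [] s
Filled-[] s (v , v≤s , s<v+0) = <⇒≱ (subst (s <_) (+-identityʳ v) s<v+0) v≤s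

Tracks : List ℕ → List ℕ → Set
Tracks occ p = ∀ s → occupied s occ ≡ true ⇔ Filled p s

Tracks-∷ : ∀ b p occ → Tracks occ p → Tracks ((b + copies b p) ∷ occ) (b ∷ p)
Tracks-∷ b p occ tracks s = mk⇔ ⇒filled ⇐filled
  where
  ⇒filled : occupied s ((b + copies b p) ∷ occ) ≡ true → Filled (b ∷ p) s
  ⇒filled s∈ with s ≡ᵇ (b + copies b p) | ≡ᵇ-reflects-≡ s (b + copies b p)
  ... | true  | ofʸ s≡ = Filled-∷⁺ b p s (inj₁ s≡)
  ... | false | ofⁿ _  = Filled-∷⁺ b p s (inj₂ (to (tracks s) s∈))
  ⇐filled : Filled (b ∷ p) s → occupied s ((b + copies b p) ∷ occ) ≡ true
  ⇐filled filled with Filled-∷⁻ b p s filled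
  ... | inj₁ refl rewrite dec-true (s ≟ s) refl = refl
  ... | inj₂ filled′ = occupied-tail s _ occ (from (tracks s) filled′)

-- Each value b of α claims the run of spots [b, b + copies b α).
record DisjointRuns (m : ℕ) (α : List ℕ) : Set where
  field
    positive : ∀ b → occupied b α ≡ true → 1 ≤ b
    fits     : ∀ b → occupied b α ≡ true → b + copies b α ≤ suc m
    apart    : ∀ v b → occupied v α ≡ true → occupied b α ≡ true → v < b → v + copies v α ≤ b

module _ {m α} (runs : DisjointRuns m α) where
  open DisjointRuns runs

  private
    run-value : ∀ p {v s} → (∀ u → copies u p ≤ copies u α) → v ≤ s → s < v + copies v p → occupied v α ≡ true
    run-value p {v} {s} p⊆α v≤s s<v+c =
      copies>0⇒occupied v α
        (<-≤-trans (+-cancelˡ-< v 0 _ (≤-<-trans (subst (_≤ s) (sym (+-identityʳ v)) v≤s) s<v+c)) (p⊆α v))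

  Filled⇒parked : ∀ p b → (∀ u → copies u p ≤ copies u α) → occupied b α ≡ true → Filled p b → occupied b p ≡ true
  Filled⇒parked p b p⊆α b∈α (v , v≤b , b<v+c) with m≤n⇒m<n∨m≡n v≤b
  ... | inj₂ refl = copies>0⇒occupied v p (+-cancelˡ-< v 0 _ (subst (_< v + copies v p) (sym (+-identityʳ v)) b<v+c))
  ... | inj₁ v<b  = ⊥-elim (<⇒≱ b<v+c (≤-trans (+-monoʳ-≤ v (p⊆α v)) (apart v b (run-value p p⊆α v≤b b<v+c) b∈α v<b)))

  ¬Filled-next : ∀ p b → (∀ u → copies u p ≤ copies u α) → occupied b α ≡ true → copies b p < copies b α →
    ¬ Filled p (b + copies b p)
  ¬Filled-next p b p⊆α b∈α unparked (v , v≤t , t<v+c) with <-cmp v b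
  ... | tri≈ _ refl _ = n≮n _ t<v+c
  ... | tri< v<b _ _ = <⇒≱ t<v+c (≤-trans (+-monoʳ-≤ v (p⊆α v)) (≤-trans (apart v b v∈α b∈α v<b) (m≤m+n b _)))
    where v∈α = run-value p p⊆α v≤t t<v+c
  ... | tri> _ _ b<v = <⇒≱ (+-monoʳ-< b unparked) (≤-trans (apart b v b∈α v∈α b<v) v≤t)
    where v∈α = run-value p p⊆α v≤t t<v+c

  Split : List ℕ → List ℕ → Set
  Split p β = ∀ v → copies v p + copies v β ≡ copies v α

  private
    Split-⊆ : ∀ p β → Split p β → ∀ v → copies v p ≤ copies v α
    Split-⊆ p β split v = subst (copies v p ≤_) (split v) (m≤m+n _ _)

    Split-move : ∀ b p γ → Split p (b ∷ γ) → Split (b ∷ p) γ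
    Split-move b p γ split v =
      trans (trans (cong (_+ copies v γ) (+-comm ⟦ v ≡ᵇ b ⟧ (copies v p))) (+-assoc (copies v p) _ _)) (split v)

    Split-unparked : ∀ b p γ → Split p (b ∷ γ) → copies b p < copies b α
    Split-unparked b p γ split = subst (copies b p <_) (trans (cong (copies b p +_) (sym (copies-head b γ))) (split b))
                                       (m<m+n (copies b p) (s≤s z≤n))

    Split-head∈ : ∀ b p γ → Split p (b ∷ γ) → occupied b α ≡ true
    Split-head∈ b p γ split = copies>0⇒occupied b α (≤-<-trans z≤n (Split-unparked b p γ split))

  -- The cars of p (most recent first) have parked; the spots they occupy are the filled initial
  -- segments of the runs, so the next car is lucky exactly when its value is new.
  luckyGo-countFresh : ∀ β p occ → Split p β → Tracks occ p → luckyGo m occ β ≡ countFresh p β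
  luckyGo-countFresh [] p occ split tracks = refl
  luckyGo-countFresh (b ∷ γ) p occ split tracks with occupied b p in b∈p
  ... | true = trans jump (luckyGo-countFresh γ (b ∷ p) (t ∷ occ) (Split-move b p γ split) (Tracks-∷ b p occ tracks))
    where
    t = b + copies b p
    b∈α = Split-head∈ b p γ split
    b∈occ : occupied b occ ≡ true
    b∈occ = from (tracks b) (b , ≤-refl , m<m+n b (occupied⇒copies>0 b p b∈p))
    1≤t : 1 ≤ t
    1≤t = ≤-trans (positive b b∈α) (m≤m+n b _)
    t≤m : t ≤ m
    t≤m = ≤-pred (≤-trans (+-monoʳ-< b (Split-unparked b p γ split)) (fits b b∈α))
    earlier-filled : ∀ s → b ≤ s → s < t → occupied s occ ≡ true
    earlier-filled s b≤s s<t = from (tracks s) (b , b≤s , s<t)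
    t-free : occupied t occ ≡ false
    t-free with occupied t occ in t∈occ
    ... | true  = ⊥-elim (¬Filled-next p b (Split-⊆ p (b ∷ γ) split) b∈α (Split-unparked b p γ split)
                                       (to (tracks t) t∈occ))
    ... | false = refl
    jump : luckyGo m occ (b ∷ γ) ≡ luckyGo m (t ∷ occ) γ
    jump with occupied b occ | b∈occ
    ... | true | refl =
      cong (λ spot → luckyGo m (spot ++ occ) γ) (firstFree-spotsFrom 1≤t t≤m (m≤m+n b _) earlier-filled t-free)
  ... | false = trans skip (cong suc (luckyGo-countFresh γ (b ∷ p) (b ∷ occ) (Split-move b p γ split) tracks′))
    where
    b∉occ : occupied b occ ≡ false
    b∉occ with occupied b occ in b∈occ
    ... | true  = ⊥-elim (Bool.not-¬ b∈p
                    (Filled⇒parked p b (Split-⊆ p (b ∷ γ) split) (Split-head∈ b p γ split) (to (tracks b) b∈occ)))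
    ... | false = refl
    skip : luckyGo m occ (b ∷ γ) ≡ suc (luckyGo m (b ∷ occ) γ)
    skip rewrite b∉occ = refl
    tracks′ : Tracks (b ∷ occ) (b ∷ p)
    tracks′ = subst (λ x → Tracks (x ∷ occ) (b ∷ p)) (trans (cong (b +_) (copies-absent b p b∈p)) (+-identityʳ b))
                    (Tracks-∷ b p occ tracks)

  lucky≡countFresh : lucky m α ≡ countFresh [] α
  lucky≡countFresh = luckyGo-countFresh α [] [] (λ v → refl) (λ s → mk⇔ (λ ()) (⊥-elim ∘ Filled-[] s))

-- Fubini rankings

IsFubini : List ℕ → Set
IsFubini α = All (λ x → x ≡ suc (countLess x α)) α

isFubini⇒IsFubini : ∀ α → isFubini α ≡ true → IsFubini α
isFubini⇒IsFubini α isF = All.map (λ {x} → ≡ᵇ⇒≡ x _) (all⁺ _ α (Equivalence.from Bool.T-≡ isF))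

IsFubini⇒isFubini : ∀ α → IsFubini α → isFubini α ≡ true
IsFubini⇒isFubini α fub = Equivalence.to Bool.T-≡ (all⁻ _ (All.map (λ {x} → ≡⇒≡ᵇ x _) fub))

fitsAtHead : ℕ → List ℕ → Bool
fitsAtHead a β = a ≡ᵇ suc (countLess a β)

module Fubini {α : List ℕ} (fub : IsFubini α) where
  open ≤-Reasoning

  rank : ∀ x → occupied x α ≡ true → x ≡ suc (countLess x α)
  rank x = lookup-occupied x α fub

  inRange : All (InRange (length α)) α
  inRange = All.zipWith bounds (fub , occupied-self α)
    where
    bounds : ∀ {x} → x ≡ suc (countLess x α) × occupied x α ≡ true → InRange (length α) x
    bounds {x} (x-rank , x∈) = subst (1 ≤_) (sym x-rank) (s≤s z≤n) , (begin
      x                             ≡⟨ x-rank ⟩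
      suc (countLess x α)           ≡⟨ +-comm 1 _ ⟩
      countLess x α + 1             ≤⟨ +-monoʳ-≤ (countLess x α) (occupied⇒copies>0 x α x∈) ⟩
      countLess x α + copies x α    ≤⟨ countLess+copies≤length x α ⟩
      length α                      ∎)

  gap : ∀ v b → occupied v α ≡ true → occupied b α ≡ true → v < b → v + copies v α ≤ b
  gap v b v∈ b∈ v<b = begin
    v + copies v α                       ≡⟨ cong (_+ copies v α) (rank v v∈) ⟩
    suc (countLess v α + copies v α)     ≡⟨ cong suc (countLess-suc v α) ⟨
    suc (countLess (suc v) α)            ≤⟨ s≤s (countLess-mono α v<b) ⟩
    suc (countLess b α)                  ≡⟨ rank b b∈ ⟨
    b                                    ∎

  rank-attained : ∀ a → a ≤ length α → a ≡ suc (countLess a α) → occupied a α ≡ true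
  rank-attained a a≤len a-rank = search (suc (length α) ∸ a) a (m+[n∸m]≡n (m≤n⇒m≤1+n a≤len)) (sym a-rank)
    where
    -- Scan z = a, a + 1, …: countLess z α stays constant while z is not a value, the first value z
    -- met has rank 1 + countLess z α = a, and beyond all values the rank would exceed length α.
    search : ∀ d z → z + d ≡ suc (length α) → suc (countLess z α) ≡ a → occupied a α ≡ true
    search d z z+d≡ z-rank with occupied z α in z∈
    ... | true = subst (λ w → occupied w α ≡ true) (trans (rank z z∈) z-rank) z∈
    search zero z z+0≡ z-rank | false = ⊥-elim (<⇒≱ (s≤s a≤len) (≤-reflexive (begin-equality
      suc (length α)                      ≡⟨ cong suc (countLess-above α (All.map (λ (_ , x≤len) → s≤s x≤len) inRange)) ⟨
      suc (countLess (suc (length α)) α)  ≡⟨ cong (λ w → suc (countLess w α)) (trans (sym (+-identityʳ z)) z+0≡) ⟨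
      suc (countLess z α)                 ≡⟨ z-rank ⟩
      a                                   ∎)))
    search (suc d) z z+d≡ z-rank | false = search d (suc z) (trans (sym (+-suc z d)) z+d≡) (begin-equality
      suc (countLess (suc z) α)           ≡⟨ cong suc (countLess-suc z α) ⟩
      suc (countLess z α + copies z α)    ≡⟨ cong (λ c → suc (countLess z α + c)) (copies-absent z α z∈) ⟩
      suc (countLess z α + 0)             ≡⟨ cong suc (+-identityʳ _) ⟩
      suc (countLess z α)                 ≡⟨ z-rank ⟩
      a                                   ∎)

  tuple : ∀ {n} → length α ≡ n → Tuple n n α
  tuple refl = refl , inRange

  disjointRuns : DisjointRuns (length α) α
  disjointRuns = record
    { positive = λ b b∈ → proj₁ (lookup-occupied b α inRange b∈)
    ; fits     = λ b b∈ → subst (λ x → x + copies b α ≤ suc (length α)) (sym (rank b b∈))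
                            (s≤s (countLess+copies≤length b α))
    ; apart    = gap
    }

  fitsAtHead≡occupied : ∀ a → a ≤ length α → fitsAtHead a α ≡ occupied a α
  fitsAtHead≡occupied a a≤len with a ≡ᵇ suc (countLess a α) | ≡ᵇ-reflects-≡ a (suc (countLess a α)) | occupied a α in a∈
  ... | true  | ofʸ a-rank | true  = refl
  ... | true  | ofʸ a-rank | false = ⊥-elim (Bool.not-¬ a∈ (rank-attained a a≤len a-rank))
  ... | false | ofⁿ ¬rank  | true  = ⊥-elim (¬rank (rank a a∈))
  ... | false | ofⁿ _      | false = refl

IsFubini∷⇒Tuple : ∀ {a β n} → IsFubini (a ∷ β) → length β ≡ n → Tuple (suc n) n β
IsFubini∷⇒Tuple fub refl = refl , All.tail (Fubini.inRange fub)

-- Closing and opening a gap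

raise : ℕ → ℕ → ℕ
raise c y = if y <ᵇ c then y else suc y

lower : ℕ → ℕ → ℕ
lower a b = if a <ᵇ b then b ∸ 1 else b

lower-self : ∀ a → lower a a ≡ a
lower-self a rewrite dec-false (a <? a) (n≮n a) = refl

raise-below : ∀ {c y} → y < c → raise c y ≡ y
raise-below {c} {y} y<c rewrite dec-true (y <? c) y<c = refl

raise-≢ : ∀ c y → raise c y ≢ c
raise-≢ c y with y <ᵇ c | <ᵇ-reflects-< y c
... | true  | ofʸ y<c = <⇒≢ y<c
... | false | ofⁿ y≮c = λ y+1≡c → y≮c (subst (y <_) y+1≡c ≤-refl)

raise-<ᵇ : ∀ c y z → (raise c y <ᵇ raise c z) ≡ (y <ᵇ z)
raise-<ᵇ c y z with y <ᵇ c | <ᵇ-reflects-< y c | z <ᵇ c | <ᵇ-reflects-< z c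
... | true  | _       | true  | _       = refl
... | false | _       | false | _       = refl
... | true  | ofʸ y<c | false | ofⁿ z≮c =
  trans (dec-true (y <? suc z) (m<n⇒m<1+n y<z)) (sym (dec-true (y <? z) y<z))
  where y<z = <-≤-trans y<c (≮⇒≥ z≮c)
... | false | ofⁿ y≮c | true  | ofʸ z<c =
  trans (dec-false (suc y <? z) (<⇒≯ (m<n⇒m<1+n z<y))) (sym (dec-false (y <? z) (<⇒≯ z<y)))
  where z<y = <-≤-trans z<c (≮⇒≥ y≮c)

countLess-raise : ∀ c y xs → countLess (raise c y) (map (raise c) xs) ≡ countLess y xs
countLess-raise c y xs = countLess-map (raise c) (raise c y) y xs (λ z → raise-<ᵇ c z y)

-- Used with c = suc a when the removed first entry a is repeated (so suc a is not a value)
-- and with c = a when it is unique.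
module Relabel {a c : ℕ} (a≤c : a ≤ c) (c≤1+a : c ≤ suc a) where

  lower-raise : ∀ y → lower a (raise c y) ≡ y
  lower-raise y with y <ᵇ c | <ᵇ-reflects-< y c
  ... | true  | ofʸ y<c rewrite dec-false (a <? y) (≤⇒≯ (≤-pred (≤-trans y<c c≤1+a))) = refl
  ... | false | ofⁿ y≮c rewrite dec-true (a <? suc y) (s≤s (≤-trans a≤c (≮⇒≥ y≮c))) = refl

  raise-lower : ∀ {b} → b ≢ c → raise c (lower a b) ≡ b
  raise-lower {b} b≢c with a <ᵇ b | <ᵇ-reflects-< a b
  raise-lower {zero}  _     | true | ofʸ ()
  raise-lower {suc b} b+1≢c | true | ofʸ a<b+1
    rewrite dec-false (b <? c) (λ b<c → b+1≢c (≤-antisym b<c (≤-trans c≤1+a a<b+1))) = refl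
  ... | false | ofⁿ a≮b rewrite dec-true (b <? c) (≤∧≢⇒< (≤-trans (≮⇒≥ a≮b) a≤c) b≢c) = refl

  raise-<ᵇ-a : ∀ y → (raise c y <ᵇ a) ≡ (y <ᵇ a)
  raise-<ᵇ-a y with y <ᵇ c | <ᵇ-reflects-< y c
  ... | true  | _        = refl
  ... | false | ofⁿ y≮c  = trans (dec-false (suc y <? a) (<⇒≱ (s≤s a≤y) ∘ <⇒≤)) (sym (dec-false (y <? a) (≤⇒≯ a≤y)))
    where a≤y = ≤-trans a≤c (≮⇒≥ y≮c)

  lower-<ᵇ-a : ∀ y → (lower a y <ᵇ a) ≡ (y <ᵇ a)
  lower-<ᵇ-a y with a <ᵇ y | <ᵇ-reflects-< a y
  lower-<ᵇ-a zero    | true | ofʸ ()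
  lower-<ᵇ-a (suc y) | true | ofʸ a<y+1 =
    trans (dec-false (y <? a) (≤⇒≯ (≤-pred a<y+1))) (sym (dec-false (suc y <? a) (<⇒≯ a<y+1)))
  ... | false | _ = refl

  raise-shift : ∀ y → raise c y ≡ (if a <ᵇ raise c y then suc y else y)
  raise-shift y with y <ᵇ c | <ᵇ-reflects-< y c
  ... | true  | ofʸ y<c rewrite dec-false (a <? y) (≤⇒≯ (≤-pred (≤-trans y<c c≤1+a))) = refl
  ... | false | ofⁿ y≮c rewrite dec-true (a <? suc y) (s≤s (≤-trans a≤c (≮⇒≥ y≮c))) = refl

  raise∘lower : ∀ β → occupied c β ≡ false → map (raise c) (map (lower a) β) ≡ β
  raise∘lower β c∉β = trans (sym (List.map-∘ β)) (List.map-id-local (All.map raise-lower (absent⇒All≢ c β c∉β)))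

  raise-injective : Injective _≡_ _≡_ (raise c)
  raise-injective {y} {z} eq = trans (sym (lower-raise y)) (trans (cong (lower a) eq) (lower-raise z))

  lower∘raise : ∀ β → map (lower a) (map (raise c) β) ≡ β
  lower∘raise β = trans (sym (List.map-∘ β)) (List.map-id-local (All.universal lower-raise β))

  IsFubini-lower : ∀ β → IsFubini (a ∷ β) → occupied c β ≡ false → IsFubini (map (lower a) β)
  IsFubini-lower β (_ ∷ β-ranks) c∉β = map⁺ (All.zipWith rank-lower (β-ranks , absent⇒All≢ c β c∉β))
    where
    rank-lower : ∀ {b} → b ≡ suc (countLess b (a ∷ β)) × b ≢ c → lower a b ≡ suc (countLess (lower a b) (map (lower a) β))
    rank-lower {b} (b-rank , b≢c) rewrite sym (cong₂ countLess (raise-lower b≢c) (raise∘lower β c∉β))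
                                          | countLess-raise c (lower a b) (map (lower a) β) with a <ᵇ b
    ... | true  = cong (_∸ 1) b-rank
    ... | false = b-rank

  IsFubini-raise : ∀ β → IsFubini β → a ≡ suc (countLess a β) → IsFubini (a ∷ map (raise c) β)
  IsFubini-raise β β-ranks a-rank = head-rank ∷ map⁺ (All.map rank-raise β-ranks)
    where
    head-rank : a ≡ suc (countLess a (a ∷ map (raise c) β))
    head-rank rewrite dec-false (a <? a) (n≮n a) | countLess-map (raise c) a a β raise-<ᵇ-a = a-rank
    rank-raise : ∀ {y} → y ≡ suc (countLess y β) → raise c y ≡ suc (countLess (raise c y) (a ∷ map (raise c) β))
    rank-raise {y} y-rank rewrite countLess-raise c y β with a <ᵇ raise c y in a<ᵇ
    ... | true  = trans (subst (λ t → raise c y ≡ (if t then suc y else y)) a<ᵇ (raise-shift y)) (cong suc y-rank)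
    ... | false = trans (subst (λ t → raise c y ≡ (if t then suc y else y)) a<ᵇ (raise-shift y)) y-rank

-- Removing the first entry

isFubiniWith : ℕ → List ℕ → Bool
isFubiniWith k α = isFubini α ∧ (countFresh [] α ≡ᵇ k)

isFubiniWith⁻ : ∀ k α → isFubiniWith k α ≡ true → IsFubini α × countFresh [] α ≡ k
isFubiniWith⁻ k α F with ∧≡true⁻ (isFubini α) _ F
... | isF , fresh≡k = isFubini⇒IsFubini α isF , ≡ᵇ⇒≡ _ k (Equivalence.from Bool.T-≡ fresh≡k)

isFubiniWith⁺ : ∀ {k α} → IsFubini α → countFresh [] α ≡ k → isFubiniWith k α ≡ true
isFubiniWith⁺ {k} {α} fub refl = ∧≡true⁺ (IsFubini⇒isFubini α fub) (dec-true (countFresh [] α ≟ k) refl)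

fFR≡∑ : ∀ m k → fFR m k ≡ ∑[ α ∈ tuples m m ] ⟦ isFubiniWith k α ⟧
fFR≡∑ m k = trans (length-filter _ (tuples m m)) (∑-cong-All (All.map lucky-as-fresh (members (tuples-enumerates m m))))
  where
  lucky-as-fresh : ∀ {α} → Tuple m m α → ⟦ isFubini α ∧ (lucky m α ≡ᵇ k) ⟧ ≡ ⟦ isFubiniWith k α ⟧
  lucky-as-fresh {α} (refl , _) with isFubini α in isF
  ... | false = refl
  ... | true  = cong (λ j → ⟦ j ≡ᵇ k ⟧) (lucky≡countFresh (Fubini.disjointRuns (isFubini⇒IsFubini α isF)))

module RepeatedHead (n k a : ℕ) where
  open Relabel {a} {suc a} (n≤1+n a) ≤-refl

  remove : ∀ {β} → Tuple (suc n) n β → isFubiniWith k (a ∷ β) ∧ occupied a β ≡ true →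
    Tuple n n (map (lower a) β) × isFubiniWith k (map (lower a) β) ∧ occupied a (map (lower a) β) ≡ true ×
    map (raise (suc a)) (map (lower a) β) ≡ β
  remove {β} (len , _) F∧a∈ = tuple , ∧≡true⁺ (isFubiniWith⁺ fub′ fresh′) a∈β′ , raise∘lower β a+1∉β
    where
    F = ∧≡true⁻ (isFubiniWith k (a ∷ β)) _ F∧a∈
    fub = proj₁ (isFubiniWith⁻ k (a ∷ β) (proj₁ F))
    a∈β = proj₂ F
    β′ = map (lower a) β
    a+1∉β : occupied (suc a) β ≡ false
    a+1∉β with occupied (suc a) β in a+1∈β
    ... | false = refl
    ... | true  = ⊥-elim (<-irrefl (+-comm a 1) (<-≤-trans (+-monoʳ-< a a-repeated)
                    (Fubini.gap fub a (suc a) (occupied-head a β) (occupied-tail (suc a) a β a+1∈β) ≤-refl)))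
      where
      a-repeated : 1 < copies a (a ∷ β)
      a-repeated = subst (1 <_) (sym (copies-head a β)) (s≤s (occupied⇒copies>0 a β a∈β))
    fub′ : IsFubini β′
    fub′ = IsFubini-lower β fub a+1∉β
    tuple : Tuple n n β′
    tuple = Fubini.tuple fub′ (trans (List.length-map (lower a) β) len)
    fresh′ : countFresh [] β′ ≡ k
    fresh′ = begin
      countFresh [] β′                          ≡⟨ countFresh-map raise-injective [] β′ ⟨
      countFresh [] (map (raise (suc a)) β′)    ≡⟨ cong (countFresh []) (raise∘lower β a+1∉β) ⟩
      countFresh [] β                           ≡⟨ countFresh-present a [] β refl a∈β ⟨
      countFresh [] (a ∷ β)                     ≡⟨ proj₂ (isFubiniWith⁻ k (a ∷ β) (proj₁ F)) ⟩
      k                                         ∎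
      where open ≡-Reasoning
    a∈β′ : occupied a β′ ≡ true
    a∈β′ = subst (λ x → occupied x β′ ≡ true) (lower-self a) (occupied-map⁺ (lower a) a β a∈β)

  insert : ∀ {β′} → Tuple n n β′ → isFubiniWith k β′ ∧ occupied a β′ ≡ true →
    Tuple (suc n) n (map (raise (suc a)) β′) ×
    isFubiniWith k (a ∷ map (raise (suc a)) β′) ∧ occupied a (map (raise (suc a)) β′) ≡ true ×
    map (lower a) (map (raise (suc a)) β′) ≡ β′
  insert {β′} (len , _) F∧a∈ = tuple , ∧≡true⁺ (isFubiniWith⁺ fub fresh) a∈β , lower∘raise β′
    where
    F = ∧≡true⁻ (isFubiniWith k β′) _ F∧a∈
    fub′ = proj₁ (isFubiniWith⁻ k β′ (proj₁ F))
    a∈β′ = proj₂ F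
    β = map (raise (suc a)) β′
    fub : IsFubini (a ∷ β)
    fub = IsFubini-raise β′ fub′ (Fubini.rank fub′ a a∈β′)
    tuple : Tuple (suc n) n β
    tuple = IsFubini∷⇒Tuple fub (trans (List.length-map _ β′) len)
    a∈β : occupied a β ≡ true
    a∈β = subst (λ x → occupied x β ≡ true) (raise-below {suc a} {a} ≤-refl) (occupied-map⁺ (raise (suc a)) a β′ a∈β′)
    fresh : countFresh [] (a ∷ β) ≡ k
    fresh = trans (countFresh-present a [] β refl a∈β)
              (trans (countFresh-map raise-injective [] β′) (proj₂ (isFubiniWith⁻ k β′ (proj₁ F))))

  count : ∑[ β ∈ tuples (suc n) n ] ⟦ isFubiniWith k (a ∷ β) ∧ occupied a β ⟧
        ≡ ∑[ β ∈ tuples n n ] ⟦ isFubiniWith k β ∧ occupied a β ⟧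
  count = count-bijection (tuples-enumerates (suc n) n) (tuples-enumerates n n)
    (map (lower a)) (map (raise (suc a))) remove insert

module UniqueHead (n k a : ℕ) where
  open Relabel {a} {a} ≤-refl (n≤1+n a)

  remove : ∀ {β} → Tuple (suc n) n β → isFubiniWith (suc k) (a ∷ β) ∧ not (occupied a β) ≡ true →
    Tuple n n (map (lower a) β) × isFubiniWith k (map (lower a) β) ∧ fitsAtHead a (map (lower a) β) ≡ true ×
    map (raise a) (map (lower a) β) ≡ β
  remove {β} (len , _) F∧a∉ =
    tuple , ∧≡true⁺ (isFubiniWith⁺ fub′ fresh′) (dec-true (a ≟ _) a-rank′) , raise∘lower β a∉β
    where
    F = ∧≡true⁻ (isFubiniWith (suc k) (a ∷ β)) _ F∧a∉
    fub = proj₁ (isFubiniWith⁻ (suc k) (a ∷ β) (proj₁ F))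
    a∉β : occupied a β ≡ false
    a∉β = trans (sym (Bool.not-involutive _)) (cong not (proj₂ F))
    β′ = map (lower a) β
    fub′ : IsFubini β′
    fub′ = IsFubini-lower β fub a∉β
    tuple : Tuple n n β′
    tuple = Fubini.tuple fub′ (trans (List.length-map (lower a) β) len)
    fresh′ : countFresh [] β′ ≡ k
    fresh′ = suc-injective (begin
      suc (countFresh [] β′)                    ≡⟨ cong suc (countFresh-map raise-injective [] β′) ⟨
      suc (countFresh [] (map (raise a) β′))    ≡⟨ cong (suc ∘ countFresh []) (raise∘lower β a∉β) ⟩
      suc (countFresh [] β)                     ≡⟨ cong suc (countFresh-absent a [] β a∉β) ⟨
      countFresh [] (a ∷ β)                     ≡⟨ proj₂ (isFubiniWith⁻ (suc k) (a ∷ β) (proj₁ F)) ⟩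
      suc k                                     ∎)
      where open ≡-Reasoning
    a-rank′ : a ≡ suc (countLess a β′)
    a-rank′ = trans (All.head fub)
                (cong suc (trans (countLess-∷-≮ {xs = β} (n≮n a)) (sym (countLess-map (lower a) a a β lower-<ᵇ-a))))

  insert : ∀ {β′} → Tuple n n β′ → isFubiniWith k β′ ∧ fitsAtHead a β′ ≡ true →
    Tuple (suc n) n (map (raise a) β′) ×
    isFubiniWith (suc k) (a ∷ map (raise a) β′) ∧ not (occupied a (map (raise a) β′)) ≡ true ×
    map (lower a) (map (raise a) β′) ≡ β′
  insert {β′} (len , _) F∧rank = tuple , ∧≡true⁺ (isFubiniWith⁺ fub fresh) (cong not a∉β) , lower∘raise β′
    where
    F = ∧≡true⁻ (isFubiniWith k β′) _ F∧rank
    fub′ = proj₁ (isFubiniWith⁻ k β′ (proj₁ F))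
    β = map (raise a) β′
    fub : IsFubini (a ∷ β)
    fub = IsFubini-raise β′ fub′ (≡ᵇ⇒≡ a _ (Equivalence.from Bool.T-≡ (proj₂ F)))
    tuple : Tuple (suc n) n β
    tuple = IsFubini∷⇒Tuple fub (trans (List.length-map _ β′) len)
    a∉β : occupied a β ≡ false
    a∉β = All≢⇒absent a β (map⁺ (All.universal (raise-≢ a) β′))
    fresh : countFresh [] (a ∷ β) ≡ suc k
    fresh = cong suc (trans (countFresh-absent a [] β a∉β)
              (trans (countFresh-map raise-injective [] β′) (proj₂ (isFubiniWith⁻ k β′ (proj₁ F)))))

  count : ∑[ β ∈ tuples (suc n) n ] ⟦ isFubiniWith (suc k) (a ∷ β) ∧ not (occupied a β) ⟧
        ≡ ∑[ β ∈ tuples n n ] ⟦ isFubiniWith k β ∧ fitsAtHead a β ⟧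
  count = count-bijection (tuples-enumerates (suc n) n) (tuples-enumerates n n)
    (map (lower a)) (map (raise a)) remove insert

choices-repeated : ∀ n k β → Tuple n n β →
  ∑[ a ∈ range1 (suc n) ] ⟦ isFubiniWith k β ∧ occupied a β ⟧ ≡ k * ⟦ isFubiniWith k β ⟧
choices-repeated n k β (_ , β∈) rewrite ∑-⟦∧⟧ (range1 (suc n)) (isFubiniWith k β) (λ a → occupied a β)
  with isFubiniWith k β in F
... | false = sym (*-zeroʳ k)
... | true  = trans (+-identityʳ _) (trans (distinct≡∑ (suc n) β (InRange-suc β∈))
                (trans (proj₂ (isFubiniWith⁻ k β F)) (sym (*-identityʳ k))))

-- a fits at the head of a Fubini ranking β exactly when a is a value of β or a = length β + 1.
choices-unique : ∀ n k β → Tuple n n β →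
  ∑[ a ∈ range1 (suc n) ] ⟦ isFubiniWith k β ∧ fitsAtHead a β ⟧ ≡ suc k * ⟦ isFubiniWith k β ⟧
choices-unique n k β (len , β∈) rewrite ∑-⟦∧⟧ (range1 (suc n)) (isFubiniWith k β) (λ a → fitsAtHead a β)
  with isFubiniWith k β in F
... | false = sym (*-zeroʳ (suc k))
... | true  = begin
  ∑[ a ∈ range1 (suc n) ] ⟦ fitsAtHead a β ⟧ + 0                         ≡⟨ +-identityʳ _ ⟩
  ∑[ a ∈ range1 (suc n) ] ⟦ fitsAtHead a β ⟧                             ≡⟨ cong (λ as → ∑ as _) (range1-∷ʳ n) ⟩
  ∑[ a ∈ range1 n ++ suc n ∷ [] ] ⟦ fitsAtHead a β ⟧                     ≡⟨ ∑-++ (range1 n) _ _ ⟩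
  ∑[ a ∈ range1 n ] ⟦ fitsAtHead a β ⟧ + (⟦ fitsAtHead (suc n) β ⟧ + 0)   ≡⟨ cong₂ _+_ values-fit last-fits ⟩
  k + 1                                                                  ≡⟨ +-comm k 1 ⟩
  suc k                                                                  ≡⟨ *-identityʳ (suc k) ⟨
  suc k * 1                                                              ∎
  where
  open ≡-Reasoning
  open Fubini (proj₁ (isFubiniWith⁻ k β F))
  values-fit : ∑[ a ∈ range1 n ] ⟦ fitsAtHead a β ⟧ ≡ k
  values-fit = begin
    ∑[ a ∈ range1 n ] ⟦ fitsAtHead a β ⟧
      ≡⟨ ∑-cong-All (All.map (λ (_ , a≤n) → cong ⟦_⟧ (fitsAtHead≡occupied _ (subst (_ ≤_) (sym len) a≤n)))
                             (range1-inRange n)) ⟩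
    ∑[ a ∈ range1 n ] ⟦ occupied a β ⟧  ≡⟨ distinct≡∑ n β β∈ ⟩
    countFresh [] β                     ≡⟨ proj₂ (isFubiniWith⁻ k β F) ⟩
    k                                   ∎
  last-fits : ⟦ fitsAtHead (suc n) β ⟧ + 0 ≡ 1
  last-fits rewrite countLess-above β (All.map (λ (_ , x≤n) → s≤s x≤n) β∈) | len | dec-true (n ≟ n) refl = refl

count-by-first-entry : ∀ n k →
  ∑[ α ∈ tuples (suc n) (suc n) ] ⟦ isFubiniWith (suc k) α ⟧
  ≡ ∑[ β ∈ tuples n n ] ∑[ a ∈ range1 (suc n) ] ⟦ isFubiniWith (suc k) β ∧ occupied a β ⟧
  + ∑[ β ∈ tuples n n ] ∑[ a ∈ range1 (suc n) ] ⟦ isFubiniWith k β ∧ fitsAtHead a β ⟧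
count-by-first-entry n k = begin
  ∑[ α ∈ tuples (suc n) (suc n) ] ⟦ isFubiniWith (suc k) α ⟧
    ≡⟨ ∑-tuples-∷ (suc n) n _ ⟩
  ∑[ a ∈ range1 (suc n) ] ∑[ β ∈ tuples (suc n) n ] ⟦ isFubiniWith (suc k) (a ∷ β) ⟧
    ≡⟨ ∑-cong (range1 (suc n)) (λ a → ∑-⟦⟧-split (tuples (suc n) n) _ (occupied a)) ⟩
  ∑[ a ∈ range1 (suc n) ] (∑[ β ∈ tuples (suc n) n ] ⟦ isFubiniWith (suc k) (a ∷ β) ∧ occupied a β ⟧
                          + ∑[ β ∈ tuples (suc n) n ] ⟦ isFubiniWith (suc k) (a ∷ β) ∧ not (occupied a β) ⟧)
    ≡⟨ ∑-cong (range1 (suc n)) (λ a → cong₂ _+_ (RepeatedHead.count n (suc k) a) (UniqueHead.count n k a)) ⟩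
  ∑[ a ∈ range1 (suc n) ] (∑[ β ∈ tuples n n ] ⟦ isFubiniWith (suc k) β ∧ occupied a β ⟧
                          + ∑[ β ∈ tuples n n ] ⟦ isFubiniWith k β ∧ fitsAtHead a β ⟧)
    ≡⟨ ∑-+ (range1 (suc n)) _ (λ a → ∑[ β ∈ tuples n n ] ⟦ isFubiniWith k β ∧ fitsAtHead a β ⟧) ⟩
  ∑[ a ∈ range1 (suc n) ] ∑[ β ∈ tuples n n ] ⟦ isFubiniWith (suc k) β ∧ occupied a β ⟧
  + ∑[ a ∈ range1 (suc n) ] ∑[ β ∈ tuples n n ] ⟦ isFubiniWith k β ∧ fitsAtHead a β ⟧
    ≡⟨ cong₂ _+_ (∑-comm (range1 (suc n)) (tuples n n) _) (∑-comm (range1 (suc n)) (tuples n n) _) ⟩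
  ∑[ β ∈ tuples n n ] ∑[ a ∈ range1 (suc n) ] ⟦ isFubiniWith (suc k) β ∧ occupied a β ⟧
  + ∑[ β ∈ tuples n n ] ∑[ a ∈ range1 (suc n) ] ⟦ isFubiniWith k β ∧ fitsAtHead a β ⟧ ∎
  where open ≡-Reasoning

theorem2p7 : (n k : ℕ) → n ≥ 1 → k ≥ 1 →
    fFR n k ≡ k * (fFR (n ∸ 1) k + fFR (n ∸ 1) (k ∸ 1))
theorem2p7 (suc n) (suc k) _ _ = begin
  fFR (suc n) (suc k)
    ≡⟨ trans (fFR≡∑ (suc n) (suc k)) (count-by-first-entry n k) ⟩
  ∑[ β ∈ tuples n n ] ∑[ a ∈ range1 (suc n) ] ⟦ isFubiniWith (suc k) β ∧ occupied a β ⟧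
  + ∑[ β ∈ tuples n n ] ∑[ a ∈ range1 (suc n) ] ⟦ isFubiniWith k β ∧ fitsAtHead a β ⟧
    ≡⟨ cong₂ _+_ (∑-cong-All (All.map (choices-repeated n (suc k) _) tuples-n))
                 (∑-cong-All (All.map (choices-unique n k _) tuples-n)) ⟩
  ∑[ β ∈ tuples n n ] (suc k * ⟦ isFubiniWith (suc k) β ⟧) + ∑[ β ∈ tuples n n ] (suc k * ⟦ isFubiniWith k β ⟧)
    ≡⟨ cong₂ _+_ (∑-*ˡ (tuples n n) (suc k) _) (∑-*ˡ (tuples n n) (suc k) _) ⟩
  suc k * fubinis (suc k) + suc k * fubinis k
    ≡⟨ *-distribˡ-+ (suc k) (fubinis (suc k)) (fubinis k) ⟨
  suc k * (fubinis (suc k) + fubinis k)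
    ≡⟨ cong (suc k *_) (cong₂ _+_ (fFR≡∑ n (suc k)) (fFR≡∑ n k)) ⟨
  suc k * (fFR n (suc k) + fFR n k) ∎
  where
  open ≡-Reasoning
  tuples-n = members (tuples-enumerates n n)
  fubinis : ℕ → ℕ
  fubinis j = ∑[ β ∈ tuples n n ] ⟦ isFubiniWith j β ⟧
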